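{- Let $c\ge 1$ be an integer and let $(W_1,\dots,W_n)$ be a stable grading of a graph $G$ with $\chi(G)\ge c+2$. Then there exist a subset $X\subseteq V(G)$ and an edge $uv$ of $G$ such that: $G[X]$ is connected; $\chi(G[X])\ge c$; $u$ and $v$ are both earlier than every vertex of $X$; and at least one of $u$, $v$ has a neighbour in $X$.
   Context: All graphs are finite and simple. A stable grading of a graph $G$ is a sequence $(W_1,\dots,W_n)$ of pairwise disjoint stable sets whose union is $V(G)$. A vertex $u$ is earlier than a vertex $v$ (with respect to the grading) if $u\in W_i$ and $v\in W_j$ for some $i<j$. -}

module Defs where

open import Data.Nat using (ℕ; _≤_; _+_)
open import Data.Fin using (Fin) renaming (_<_ to _<ᶠ_)
open import Data.Fin.Subset using (Subset; _∈_; _∉_)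
open import Data.Product using (Σ; ∃; ∃-syntax; _×_)
open import Data.Sum using (_⊎_)
open import Relation.Nullary using (¬_; Dec)
open import Relation.Binary.PropositionalEquality using (_≡_; _≢_)

record Graph (N : ℕ) : Set₁ where
  field
    Adj    : Fin N → Fin N → Set
    adj?   : ∀ u v → Dec (Adj u v)
    sym    : ∀ {u v} → Adj u v → Adj v u
    irrefl : ∀ {u} → ¬ Adj u u
open Graph public

module _ {N : ℕ} (G : Graph N) where

  Stable : Subset N → Set
  Stable S = ∀ u v → u ∈ S → v ∈ S → ¬ Adj G u v

  record StableGrading (n : ℕ) : Set where
    field
      W        : Fin n → Subset N
      stable   : ∀ i → Stable (W i)
      disjoint : ∀ i j → i ≢ j → ∀ v → v ∈ W i → v ∉ W j
      cover    : ∀ v → ∃[ i ] (v ∈ W i)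

  Earlier : ∀ {n} → StableGrading n → Fin N → Fin N → Set
  Earlier {n} Γ u v =
    Σ (Fin n) λ i → Σ (Fin n) λ j →
      u ∈ StableGrading.W Γ i × v ∈ StableGrading.W Γ j × i <ᶠ j

  Colouring : Subset N → ℕ → Set
  Colouring X k =
    Σ ((v : Fin N) → v ∈ X → Fin k) λ f →
      ∀ u v (u∈X : u ∈ X) (v∈X : v ∈ X) → Adj G u v → f u u∈X ≢ f v v∈X

  χ≥ : Subset N → ℕ → Set
  χ≥ X k = ∀ m → Colouring X m → k ≤ m

  data WalkIn (X : Subset N) : Fin N → Fin N → Set where
    here : ∀ {u} → u ∈ X → WalkIn X u u
    step : ∀ {u w v} → u ∈ X → Adj G u w → WalkIn X w v → WalkIn X u v

  Connected : Subset N → Set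
  Connected X = ∀ u v → u ∈ X → v ∈ X → WalkIn X u v

open import Data.Fin.Subset using (⊤)
χG≥ : ∀ {N} → Graph N → ℕ → Set
χG≥ G k = χ≥ G ⊤ k

module Submission where

open import Defs
open import Data.Nat using (ℕ; zero; suc; _≤_; _<_; _+_; _<?_)
open import Data.Nat.Properties using (+-comm; <-cmp; ≮⇒≥; ≤-antisym; ≤-pred; <-trans; <-irrefl; 1+n≰n)
open import Data.Nat.Induction using (<-wellFounded)
open import Data.Fin using (Fin; toℕ; inject≤) renaming (zero to fzero; suc to fsuc)
open import Data.Fin.Properties using (¬Fin0; any?; all?; _≟_; toℕ-injective; suc-injective; inject≤-injective)
open import Data.Fin.Subset using (Subset; _∈_; _∉_; _⊆_; ∣_∣; ⊤; _-_; Nonempty; ⁅_⁆)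
open import Data.Fin.Subset.Properties
  using (_∈?_; nonempty?; ⊆-trans; x∈p∧x≢y⇒x∈p-y; p─q⊆p; x∈p⇒∣p-x∣<∣p∣; p⊂q⇒∣p∣<∣q∣)
open import Data.Vec using (Vec; []; _∷_; there; lookup; tabulate)
open import Data.Vec.Properties using (lookup∘tabulate; []=⇒lookup; lookup⇒[]=)
open import Data.Product using (Σ; Σ-syntax; ∃; ∃-syntax; _×_; _,_; proj₁; proj₂)
open import Data.Sum using (_⊎_; inj₁; inj₂; [_,_])
open import Data.Bool using (true)
open import Data.Empty using (⊥-elim)
open import Function using (_∘_; _on_; id)
open import Induction.WellFounded using (Acc; acc)
open import Level using (0ℓ)
open import Relation.Binary.Construct.On as On using ()
open import Relation.Binary.Definitions using (tri<; tri≈; tri>)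
open import Relation.Binary.PropositionalEquality using (_≡_; _≢_; refl; trans; subst) renaming (sym to ≡-sym)
open import Relation.Nullary using (¬_; Dec; yes; no; does)
open import Relation.Nullary.Decidable using (dec-true; map′; _×-dec_; _⊎-dec_; _→-dec_; ¬?)
open import Relation.Unary using (Pred; Decidable)

-- Call a vertex late if it has an earlier neighbour. Two adjacent vertices that are not late
-- would have to lie in the same stable level, so the non-late vertices form a stable set and
-- the late ones span a subgraph of chromatic number at least c + 1; let K be a component of it
-- with χ(G[K]) ≥ c + 1 and q a vertex of K in the lowest level. The vertices of K outside q's
-- level lie strictly above it, and they span a subgraph of chromatic number at least c (q's level
-- is stable); let X be a component of it with χ(G[X]) ≥ c. A walk in K from X to q leaves X
-- through an edge xy with y on q's level, and the late vertex y has an earlier neighbour u: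
-- uy is the required edge.

x∉p-x : ∀ {n} (p : Subset n) (x : Fin n) → x ∉ p - x
x∉p-x (_ ∷ p) fzero ()
x∉p-x (_ ∷ p) (fsuc x) (there x∈p-x) = x∉p-x p x x∈p-x

module _ {N : ℕ} {P : Pred (Fin N) 0ℓ} (P? : Decidable P) where

  subsetOf : Subset N
  subsetOf = tabulate (does ∘ P?)

  ∈-subsetOf⁺ : ∀ {v} → P v → v ∈ subsetOf
  ∈-subsetOf⁺ {v} p =
    lookup⇒[]= v subsetOf (trans (lookup∘tabulate (does ∘ P?) v) (dec-true (P? v) p))

  ∈-subsetOf⁻ : ∀ {v} → v ∈ subsetOf → P v
  ∈-subsetOf⁻ {v} v∈ =
    fromYes (P? v) (trans (≡-sym (lookup∘tabulate (does ∘ P?) v)) ([]=⇒lookup v∈))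
    where
    fromYes : ∀ {A : Set} (a? : Dec A) → does a? ≡ true → A
    fromYes (yes a) _ = a
    fromYes (no _) ()

  minimiser : (f : Fin N → ℕ) → ∀ {a} → P a → ∃ λ m → P m × (∀ b → P b → f m ≤ f b)
  minimiser f {a} = go a (On.wellFounded f <-wellFounded a)
    where
    go : ∀ a → Acc (_<_ on f) a → P a → ∃ λ m → P m × (∀ b → P b → f m ≤ f b)
    go a (acc smaller) pa with any? (λ b → P? b ×-dec (f b <? f a))
    ... | yes (b , pb , fb<fa) = go b (smaller fb<fa) pb
    ... | no none = a , pa , λ b pb → ≮⇒≥ (λ fb<fa → none (b , pb , fb<fa))

module _ {N : ℕ} where

  _∖_ : Subset N → Subset N → Subset N
  S ∖ R = subsetOf (λ v → v ∈? S ×-dec ¬? (v ∈? R))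

  ∈∖⁺ : ∀ {S R v} → v ∈ S → v ∉ R → v ∈ S ∖ R
  ∈∖⁺ {S} {R} v∈S v∉R = ∈-subsetOf⁺ (λ v → v ∈? S ×-dec ¬? (v ∈? R)) (v∈S , v∉R)

  ∈∖⁻ : ∀ {S R v} → v ∈ S ∖ R → v ∈ S × v ∉ R
  ∈∖⁻ {S} {R} = ∈-subsetOf⁻ (λ v → v ∈? S ×-dec ¬? (v ∈? R))

  ∖⊆ : ∀ {S} R → S ∖ R ⊆ S
  ∖⊆ R = proj₁ ∘ ∈∖⁻ {R = R}

  ∣∖∣<∣∣ : ∀ {S R v} → v ∈ S → v ∈ R → ∣ S ∖ R ∣ < ∣ S ∣
  ∣∖∣<∣∣ {R = R} v∈S v∈R =
    p⊂q⇒∣p∣<∣q∣ (∖⊆ R , _ , v∈S , λ v∈S∖R → proj₂ (∈∖⁻ v∈S∖R) v∈R)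

anyVec? : ∀ {k} m {P : Pred (Vec (Fin k) m) 0ℓ} → Decidable P → Dec (∃ P)
anyVec? zero P? = map′ ([] ,_) (λ { ([] , p) → p }) (P? [])
anyVec? (suc m) P? =
  map′ (λ (a , c , p) → a ∷ c , p) (λ { (a ∷ c , p) → a , c , p })
       (any? λ a → anyVec? m (P? ∘ (a ∷_)))

module _ {N : ℕ} (G : Graph N) where

  private variable
    X Y S T : Subset N
    u v w : Fin N
    k m : ℕ

  walk-head : WalkIn G X u v → u ∈ X
  walk-head (here u∈X)     = u∈X
  walk-head (step u∈X _ _) = u∈X

  walk-last : WalkIn G X u v → v ∈ X
  walk-last (here v∈X)    = v∈X
  walk-last (step _ _ ws) = walk-last ws

  walk-mono : X ⊆ Y → WalkIn G X u v → WalkIn G Y u v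
  walk-mono X⊆Y (here u∈X)       = here (X⊆Y u∈X)
  walk-mono X⊆Y (step u∈X u~ ws) = step (X⊆Y u∈X) u~ (walk-mono X⊆Y ws)

  _++ʷ_ : WalkIn G X u v → WalkIn G X v w → WalkIn G X u w
  here _         ++ʷ vs = vs
  step u∈X u~ ws ++ʷ vs = step u∈X u~ (ws ++ʷ vs)

  walk-snoc : WalkIn G X u v → Adj G v w → w ∈ X → WalkIn G X u w
  walk-snoc ws v~w w∈X = ws ++ʷ step (walk-last ws) v~w (here w∈X)

  walk-reverse : WalkIn G X u v → WalkIn G X v u
  walk-reverse (here u∈X)       = here u∈X
  walk-reverse (step u∈X u~ ws) = walk-snoc (walk-reverse ws) (sym G u~) u∈X

  LeavesOnce : Subset N → Fin N → Fin N → Set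
  LeavesOnce X u v = u ≡ v ⊎ ∃ λ w → Adj G u w × WalkIn G (X - u) w v

  walk-split : ∀ u → WalkIn G X v w → WalkIn G (X - u) v w ⊎ LeavesOnce X u w
  walk-split u (here {v} v∈X) with v ≟ u
  ... | yes refl = inj₂ (inj₁ refl)
  ... | no v≢u   = inj₁ (here (x∈p∧x≢y⇒x∈p-y v∈X v≢u))
  walk-split u (step {v} {w′} v∈X v~w′ ws) with walk-split u ws
  ... | inj₂ leaves = inj₂ leaves
  ... | inj₁ avoids with v ≟ u
  ...   | yes refl = inj₂ (inj₂ (w′ , v~w′ , avoids))
  ...   | no v≢u   = inj₁ (step (x∈p∧x≢y⇒x∈p-y v∈X v≢u) v~w′ avoids)

  walk⇒leavesOnce : WalkIn G X u v → LeavesOnce X u v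
  walk⇒leavesOnce {X} {u} ws =
    [ (λ avoids → ⊥-elim (x∉p-x X u (walk-head avoids))) , id ] (walk-split u ws)

  walk? : ∀ X u v → Dec (WalkIn G X u v)
  walk? X = go X (On.wellFounded ∣_∣ <-wellFounded X)
    where
    go : ∀ X → Acc (_<_ on ∣_∣) X → ∀ u v → Dec (WalkIn G X u v)
    go X (acc smaller) u v with u ∈? X
    ... | no u∉X  = no (u∉X ∘ walk-head)
    ... | yes u∈X = map′ fromLeaves walk⇒leavesOnce leavesOnce?
      where
      leavesOnce? : Dec (LeavesOnce X u v)
      leavesOnce? = (u ≟ v) ⊎-dec any? λ w →
        adj? G u w ×-dec go (X - u) (smaller (x∈p⇒∣p-x∣<∣p∣ u∈X)) w v
      fromLeaves : LeavesOnce X u v → WalkIn G X u v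
      fromLeaves (inj₁ refl)            = here u∈X
      fromLeaves (inj₂ (w , u~w , ws)) = step u∈X u~w (walk-mono (p─q⊆p X ⁅ u ⁆) ws)

  ClosedIn : Subset N → Subset N → Set
  ClosedIn S X = ∀ {x y} → x ∈ X → y ∈ S → Adj G x y → y ∈ X

  walk-restrict : ClosedIn S X → WalkIn G S u v → u ∈ X → WalkIn G X u v
  walk-restrict X-closed (here _)        u∈X = here u∈X
  walk-restrict X-closed (step _ u~w ws) u∈X =
    step u∈X u~w (walk-restrict X-closed ws (X-closed u∈X (walk-head ws) u~w))

  walk-exit : WalkIn G S u v → u ∈ X → v ∉ X →
              ∃ λ x → ∃ λ y → x ∈ X × y ∈ S × y ∉ X × Adj G x y
  walk-exit (here _) u∈X v∉X = ⊥-elim (v∉X u∈X)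
  walk-exit {X = X} (step {u} {w} _ u~w ws) u∈X v∉X with w ∈? X
  ... | yes w∈X = walk-exit ws w∈X v∉X
  ... | no w∉X  = u , w , u∈X , walk-head ws , w∉X , u~w

  component : Subset N → Fin N → Subset N
  component S a = subsetOf (walk? S a)

  ∈-component : u ∈ S → u ∈ component S u
  ∈-component {u = u} {S = S} u∈S = ∈-subsetOf⁺ (walk? S u) (here u∈S)

  component⊆ : ∀ a → component S a ⊆ S
  component⊆ {S} a v∈C = walk-last (∈-subsetOf⁻ (walk? S a) v∈C)

  component-closedIn : ∀ a → ClosedIn S (component S a)
  component-closedIn {S} a x∈C y∈S x~y =
    ∈-subsetOf⁺ (walk? S a) (walk-snoc (∈-subsetOf⁻ (walk? S a) x∈C) x~y y∈S)

  component-connected : ∀ a → Connected G (component S a)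
  component-connected {S} a u v u∈C v∈C =
    walk-restrict (component-closedIn a)
      (walk-reverse (∈-subsetOf⁻ (walk? S a) u∈C) ++ʷ ∈-subsetOf⁻ (walk? S a) v∈C) u∈C

  ∖-closedIn : ∀ {R} → ClosedIn S R → ClosedIn S (S ∖ R)
  ∖-closedIn R-closed x∈S∖R y∈S x~y =
    ∈∖⁺ y∈S λ y∈R → proj₂ (∈∖⁻ x∈S∖R) (R-closed y∈R (proj₁ (∈∖⁻ x∈S∖R)) (sym G x~y))

  closedIn-trans : X ⊆ Y → ClosedIn Y X → ClosedIn S Y → ClosedIn S X
  closedIn-trans X⊆Y X-closed Y-closed x∈X y∈S x~y =
    X-closed x∈X (Y-closed (X⊆Y x∈X) y∈S x~y) x~y

  colouring-weaken : m ≤ k → Colouring G X m → Colouring G X k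
  colouring-weaken m≤k (f , f-proper) =
    (λ v v∈X → inject≤ (f v v∈X) m≤k) ,
    λ u v u∈X v∈X u~v → f-proper u v u∈X v∈X u~v ∘ inject≤-injective m≤k m≤k _ _

  colouring-empty : ¬ Nonempty X → Colouring G X 0
  colouring-empty empty =
    (λ v v∈X → ⊥-elim (empty (v , v∈X))) , λ u _ u∈X _ _ → ⊥-elim (empty (u , u∈X))

  ¬colouring⇒χ≥ : ¬ Colouring G X k → χ≥ G X (suc k)
  ¬colouring⇒χ≥ ¬col m col = ≮⇒≥ λ m<1+k → ¬col (colouring-weaken (≤-pred m<1+k) col)

  χ≥⇒¬colouring : χ≥ G X (suc k) → ¬ Colouring G X k
  χ≥⇒¬colouring χ col = 1+n≰n (χ _ col)

  χ≥⇒nonempty : χ≥ G X (suc k) → Nonempty X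
  χ≥⇒nonempty {X} χ with nonempty? X
  ... | yes nonempty = nonempty
  ... | no empty with χ 0 (colouring-empty empty)
  ...   | ()

  colouring? : ∀ X k → Dec (Colouring G X k)
  colouring? X zero =
    map′ colouring-empty (λ (f , _) (v , v∈X) → ¬Fin0 (f v v∈X)) (¬? (nonempty? X))
  colouring? X (suc k) =
    map′ (λ (c , c-proper) → (λ v _ → lookup c v) , c-proper)
         (λ col → tabulate (extend col) , extend-proper col)
         (anyVec? N properOn?)
    where
    ProperOn : Vec (Fin (suc k)) N → Set
    ProperOn c = ∀ u v → u ∈ X → v ∈ X → Adj G u v → lookup c u ≢ lookup c v

    properOn? : ∀ c → Dec (ProperOn c)
    properOn? c = all? λ u → all? λ v →
      (u ∈? X) →-dec ((v ∈? X) →-dec (adj? G u v →-dec ¬? (lookup c u ≟ lookup c v)))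

    extend : Colouring G X (suc k) → Fin N → Fin (suc k)
    extend (f , _) v with v ∈? X
    ... | yes v∈X = f v v∈X
    ... | no _    = fzero

    extend-proper : ∀ col → ProperOn (tabulate (extend col))
    extend-proper col@(_ , f-proper) u v u∈X v∈X u~v
      rewrite lookup∘tabulate (extend col) u | lookup∘tabulate (extend col) v
      with u ∈? X | v ∈? X
    ... | yes u∈X′ | yes v∈X′ = f-proper u v u∈X′ v∈X′ u~v
    ... | no u∉X   | _        = ⊥-elim (u∉X u∈X)
    ... | _        | no v∉X   = ⊥-elim (v∉X v∈X)

  colouring-∪ : ∀ {R} → ClosedIn S R →
                Colouring G R k → Colouring G (S ∖ R) k → Colouring G S k
  colouring-∪ {S} {k = k} {R} R-closed (f , f-proper) (g , g-proper) = h , h-proper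
    where
    pick : ∀ v → v ∈ S → Dec (v ∈ R) → Fin k
    pick v _   (yes v∈R) = f v v∈R
    pick v v∈S (no v∉R)  = g v (∈∖⁺ v∈S v∉R)

    h : ∀ v → v ∈ S → Fin k
    h v v∈S = pick v v∈S (v ∈? R)

    h-proper : ∀ u v (u∈S : u ∈ S) (v∈S : v ∈ S) → Adj G u v → h u u∈S ≢ h v v∈S
    h-proper u v u∈S v∈S u~v with u ∈? R | v ∈? R
    ... | yes u∈R | yes v∈R = f-proper u v u∈R v∈R u~v
    ... | no _    | no _    = g-proper u v _ _ u~v
    ... | yes u∈R | no v∉R  = ⊥-elim (v∉R (R-closed u∈R v∈S u~v))
    ... | no u∉R  | yes v∈R = ⊥-elim (u∉R (R-closed v∈R u∈S (sym G u~v)))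

  χ≥-remove-stable : Stable G (S ∖ T) → χ≥ G S (suc k) → χ≥ G T k
  χ≥-remove-stable {S} {T} S∖T-stable χS m (f , f-proper) = ≤-pred (χS (suc m) (h , h-proper))
    where
    pick : ∀ v → Dec (v ∈ T) → Fin (suc m)
    pick v (yes v∈T) = fsuc (f v v∈T)
    pick v (no _)    = fzero

    h : ∀ v → v ∈ S → Fin (suc m)
    h v _ = pick v (v ∈? T)

    h-proper : ∀ u v (u∈S : u ∈ S) (v∈S : v ∈ S) → Adj G u v → h u u∈S ≢ h v v∈S
    h-proper u v u∈S v∈S u~v with u ∈? T | v ∈? T
    ... | yes u∈T | yes v∈T = f-proper u v u∈T v∈T u~v ∘ suc-injective
    ... | yes _   | no _    = λ ()
    ... | no _    | yes _   = λ ()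
    ... | no u∉T  | no v∉T  = ⊥-elim (S∖T-stable u v (∈∖⁺ u∈S u∉T) (∈∖⁺ v∈S v∉T) u~v)

  -- If every component of G[S] were k-colourable, so would be G[S].
  χ≥-component : χ≥ G S (suc k) →
                 Σ[ X ∈ Subset N ] X ⊆ S × Connected G X × ClosedIn S X × χ≥ G X (suc k)
  χ≥-component {S} {k} = go S (On.wellFounded ∣_∣ <-wellFounded S)
    where
    go : ∀ S → Acc (_<_ on ∣_∣) S → χ≥ G S (suc k) →
         Σ[ X ∈ Subset N ] X ⊆ S × Connected G X × ClosedIn S X × χ≥ G X (suc k)
    go S (acc smaller) χS with χ≥⇒nonempty χS
    ... | a , a∈S with colouring? (component S a) k | colouring? (S ∖ component S a) k
    ...   | no ¬colR | _ =
      component S a , component⊆ a , component-connected a , component-closedIn a ,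
      ¬colouring⇒χ≥ ¬colR
    ...   | yes colR | yes colZ =
      ⊥-elim (χ≥⇒¬colouring χS (colouring-∪ (component-closedIn a) colR colZ))
    ...   | yes _    | no ¬colZ =
      let (X , X⊆Z , X-connected , X-closed , χX) =
            go (S ∖ component S a) (smaller (∣∖∣<∣∣ a∈S (∈-component a∈S)))
               (¬colouring⇒χ≥ ¬colZ)
      in  X , ⊆-trans X⊆Z (∖⊆ (component S a)) , X-connected ,
          closedIn-trans X⊆Z X-closed (∖-closedIn (component-closedIn a)) , χX

module Graded {N : ℕ} (G : Graph N) {n : ℕ} (Γ : StableGrading G n) where
  open StableGrading Γ

  private variable
    K X : Subset N
    q u v : Fin N
    k : ℕ

  rank : Fin N → ℕ
  rank v = toℕ (proj₁ (cover v))

  earlier : rank u < rank v → Earlier G Γ u v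
  earlier {u} {v} u<v = _ , _ , proj₂ (cover u) , proj₂ (cover v) , u<v

  adjacent⇒rank≢ : Adj G u v → rank u ≢ rank v
  adjacent⇒rank≢ {u} {v} u~v u≡v =
    stable _ u v (proj₂ (cover u)) v∈level-u u~v
    where
    v∈level-u : v ∈ W (proj₁ (cover u))
    v∈level-u = subst (λ i → v ∈ W i) (toℕ-injective (≡-sym u≡v)) (proj₂ (cover v))

  HasEarlierNeighbour : Fin N → Set
  HasEarlierNeighbour v = ∃ λ u → Adj G u v × rank u < rank v

  hasEarlierNeighbour? : Decidable HasEarlierNeighbour
  hasEarlierNeighbour? v = any? λ u → adj? G u v ×-dec (rank u <? rank v)

  late : Subset N
  late = subsetOf hasEarlierNeighbour?

  χ≥-late : χG≥ G (suc k) → χ≥ G late k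
  χ≥-late = χ≥-remove-stable G early-stable
    where
    early-stable : Stable G (⊤ ∖ late)
    early-stable u v u-early v-early u~v with <-cmp (rank u) (rank v)
    ... | tri< u<v _ _ = proj₂ (∈∖⁻ v-early) (∈-subsetOf⁺ hasEarlierNeighbour? (u , u~v , u<v))
    ... | tri≈ _ u≡v _ = adjacent⇒rank≢ u~v u≡v
    ... | tri> _ _ v<u = proj₂ (∈∖⁻ u-early) (∈-subsetOf⁺ hasEarlierNeighbour? (v , sym G u~v , v<u))

  Above : Subset N → Fin N → Fin N → Set
  Above K q v = v ∈ K × rank q < rank v

  above? : ∀ K q → Decidable (Above K q)
  above? K q v = v ∈? K ×-dec (rank q <? rank v)

  above : Subset N → Fin N → Subset N
  above K q = subsetOf (above? K q)

  χ≥-above : (∀ v → v ∈ K → rank q ≤ rank v) → χ≥ G K (suc k) → χ≥ G (above K q) k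
  χ≥-above {K} {q} q-lowest = χ≥-remove-stable G level-stable
    where
    on-level : ∀ {v} → v ∈ K ∖ above K q → rank v ≡ rank q
    on-level v∈ = let (v∈K , v∉above) = ∈∖⁻ v∈ in
      ≤-antisym (≮⇒≥ λ q<v → v∉above (∈-subsetOf⁺ (above? K q) (v∈K , q<v))) (q-lowest _ v∈K)

    level-stable : Stable G (K ∖ above K q)
    level-stable u v u∈ v∈ u~v = adjacent⇒rank≢ u~v (trans (on-level u∈) (≡-sym (on-level v∈)))

  EarlierEdgeAt : Subset N → Set
  EarlierEdgeAt X =
    Σ (Fin N) λ u → Σ (Fin N) λ v → Adj G u v ×
      (∀ x → x ∈ X → Earlier G Γ u x × Earlier G Γ v x) ×
      (∃[ x ] (x ∈ X × (Adj G u x ⊎ Adj G v x)))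

  earlierEdgeAt : K ⊆ late → Connected G K → q ∈ K → (∀ v → v ∈ K → rank q ≤ rank v) →
                  X ⊆ above K q → ClosedIn G (above K q) X → Nonempty X → EarlierEdgeAt X
  earlierEdgeAt {K} {q} {X} K⊆late K-connected q∈K q-lowest X⊆above X-closed (x₀ , x₀∈X) =
    let (x , y , x∈X , y∈K , y∉X , x~y) =
          walk-exit G (K-connected x₀ q (proj₁ (inAbove x₀∈X)) q∈K) x₀∈X q∉X
        (u , u~y , u<y) = ∈-subsetOf⁻ hasEarlierNeighbour? (K⊆late y∈K)
        y<X : ∀ {x′} → x′ ∈ X → rank y < rank x′
        y<X x′∈X = subst (_< _) (≡-sym (exit-level x∈X y∈K y∉X x~y)) (proj₂ (inAbove x′∈X))
    in  u , y , u~y , (λ x′ x′∈X → earlier (<-trans u<y (y<X x′∈X)) , earlier (y<X x′∈X)) ,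
        x , x∈X , inj₂ (sym G x~y)
    where
    inAbove : ∀ {v} → v ∈ X → Above K q v
    inAbove = ∈-subsetOf⁻ (above? K q) ∘ X⊆above

    q∉X : q ∉ X
    q∉X q∈X = <-irrefl refl (proj₂ (inAbove q∈X))

    exit-level : ∀ {x y} → x ∈ X → y ∈ K → y ∉ X → Adj G x y → rank y ≡ rank q
    exit-level x∈X y∈K y∉X x~y = ≤-antisym
      (≮⇒≥ λ q<y → y∉X (X-closed x∈X (∈-subsetOf⁺ (above? K q) (y∈K , q<y)) x~y))
      (q-lowest _ y∈K)

lemma4p2 : (c : ℕ) → 1 ≤ c → {N : ℕ} (G : Graph N) {n : ℕ} (Γ : StableGrading G n) →
    χG≥ G (c + 2) →
    Σ (Subset N) λ X → Σ (Fin N) λ u → Σ (Fin N) λ v →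
      Connected G X × χ≥ G X c × Adj G u v ×
      (∀ x → x ∈ X → Earlier G Γ u x × Earlier G Γ v x) ×
      (∃[ x ] (x ∈ X × (Adj G u x ⊎ Adj G v x)))
lemma4p2 zero    ()
lemma4p2 (suc k) _ G Γ χG≥c+2 =
  let (K , K⊆late , K-connected , _ , χK) = χ≥-component G (χ≥-late χG≥3+k)
      (q , q∈K , q-lowest) = minimiser (_∈? K) rank (proj₂ (χ≥⇒nonempty G χK))
      (X , X⊆above , X-connected , X-closed , χX) = χ≥-component G (χ≥-above q-lowest χK)
      (u , v , edge) =
        earlierEdgeAt K⊆late K-connected q∈K q-lowest X⊆above X-closed (χ≥⇒nonempty G χX)
  in  X , u , v , X-connected , χX , edge
  where
  open Graded G Γ
  χG≥3+k : χG≥ G (3 + k)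
  χG≥3+k = subst (χG≥ G) (+-comm (suc k) 2) χG≥c+2
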